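{- Let $\mathfrak{O} = \mathfrak{O}_s \cup \mathfrak{O}_r$ be an ontology (with static part $\mathfrak{O}_s$ and refutable part $\mathfrak{O}_r$) and $\alpha$ an axiom with $\mathfrak{O}\models\alpha$ and $\mathfrak{O}_s\not\models\alpha$. Let $J_1,\ldots,J_k$ be all justifications for $\alpha$ in $\mathfrak{O}$ (minimal subsets $J\subseteq\mathfrak{O}_r$ with $\mathfrak{O}_s\cup J\models\alpha$) and $H$ a minimal hitting set of $J_1,\ldots,J_k$. Let $\mathfrak{O}'$ be the ontology obtained from $\mathfrak{O}_r$ by replacing each $\beta\in H$ by an axiom $\gamma$ that is weaker than $\beta$ (i.e., $\mathit{Con}(\{\gamma\})\subset\mathit{Con}(\{\beta\})$) such that $\mathfrak{O}_s\cup(J_{i_j}\setminus\{\beta\})\cup\{\gamma\}\not\models\alpha$ for every justification $J_{i_j}$ containing $\beta$. Then $\mathit{Con}(\mathfrak{O}_s\cup\mathfrak{O}')\subseteq\mathit{Con}(\mathfrak{O})$, but in general we may still have $\alpha\in\mathit{Con}(\mathfrak{O}_s\cup\mathfrak{O}')$.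
   Context: Ontologies are finite sets of axioms with a monotone consequence relation; $\mathit{Con}(\mathfrak{O})$ denotes the set of consequences of $\mathfrak{O}$. The ontology is split into a static part $\mathfrak{O}_s$ (kept unchanged) and a refutable part $\mathfrak{O}_r$ (which may be modified). -}

module Defs where

open import Data.List using (List; []; _∷_; _++_)
open import Data.List.Membership.Propositional using (_∈_; _∉_)
open import Data.List.Relation.Binary.Subset.Propositional using (_⊆_)
open import Data.Product using (Σ; ∃; _×_; _,_)
open import Data.Sum using (_⊎_)
open import Relation.Binary.PropositionalEquality using (_≡_; _≢_)
open import Relation.Nullary using (¬_)
open import Function.Bundles using (_⇔_)

-- An abstract (Tarskian) consequence relation on finite sets of axioms,
-- finite sets being represented by lists (order / duplicates irrelevant
-- because of monotonicity).
record ConsequenceRelation (A : Set) : Set₁ where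
  infix 4 _⊨_
  field
    _⊨_       : List A → A → Set
    reflexive : ∀ {S x} → x ∈ S → S ⊨ x
    monotone  : ∀ {S T x} → S ⊆ T → S ⊨ x → T ⊨ x
    cut       : ∀ {S T x} → (∀ {y} → y ∈ T → S ⊨ y) → T ⊨ x → S ⊨ x

  Con : List A → A → Set
  Con O φ = O ⊨ φ

  _⊆Con_ : List A → List A → Set
  O₁ ⊆Con O₂ = ∀ φ → Con O₁ φ → Con O₂ φ

  Weaker : A → A → Set
  Weaker γ β = ((γ ∷ []) ⊆Con (β ∷ [])) × (∃ λ φ → Con (β ∷ []) φ × ¬ Con (γ ∷ []) φ)

  IsJustification : List A → List A → A → List A → Set
  IsJustification Os Or α J =
    J ⊆ Or × (Os ++ J) ⊨ α ×
    (∀ J' → J' ⊆ J → (Os ++ J') ⊨ α → J ⊆ J')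

IsHittingSet : {A : Set} → List (List A) → List A → Set
IsHittingSet Js H = ∀ {J} → J ∈ Js → ∃ λ x → x ∈ J × x ∈ H

IsMinimalHittingSet : {A : Set} → List (List A) → List A → Set
IsMinimalHittingSet Js H =
  IsHittingSet Js H × (∀ H' → H' ⊆ H → IsHittingSet Js H' → H ⊆ H')

record RepairSetting (A : Set) (C : ConsequenceRelation A) : Set where
  open ConsequenceRelation C
  field
    Os Or : List A
    α     : A
    O⊨α   : (Os ++ Or) ⊨ α
    Os⊭α  : ¬ (Os ⊨ α)
    Js    : List (List A)
    Js-just : ∀ {J} → J ∈ Js → IsJustification Os Or α J
    Js-all  : ∀ J → IsJustification Os Or α J →
              ∃ λ J' → J' ∈ Js × J ⊆ J' × J' ⊆ J
    H     : List A
    H-min : IsMinimalHittingSet Js H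
    γ     : A → A
    γ-weaker : ∀ {β} → β ∈ H → Weaker (γ β) β
    -- for every justification J ∋ β, Os ∪ (J ∖ {β}) ∪ {γ β} ⊭ α,
    -- where J⁻ is any list representing the set J ∖ {β}
    γ-breaks : ∀ {β J} → β ∈ H → J ∈ Js → β ∈ J →
               ∀ J⁻ → (∀ x → x ∈ J⁻ ⇔ (x ∈ J × x ≢ β)) →
               ¬ ((Os ++ J⁻ ++ (γ β ∷ [])) ⊨ α)

  IsRepaired : List A → Set
  IsRepaired O' =
    ∀ x → x ∈ O' ⇔ ((x ∈ Or × x ∉ H) ⊎ (∃ λ β → β ∈ H × x ≡ γ β))

-- Every element of a minimal hitting set lies in some justification, hence in
-- the refutable part; its weakening γ β follows from β. So every axiom of
-- Os ∪ O' is a consequence of O, and cut gives Con(Os ∪ O') ⊆ Con(O).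
-- For the second half, let α follow from b₁ alone, from b₂ alone, and from
-- the weakenings g₁ of b₁ and g₂ of b₂ together: the justifications are {b₁}
-- and {b₂}, weakening each bᵢ to gᵢ breaks its justification, yet the two
-- weakenings jointly still entail α.
module Submission where

open import Defs
open import Data.Bool using (Bool; true; false; T)
open import Data.Empty using (⊥-elim)
open import Data.List using (List; []; _∷_; _++_; [_])
open import Data.List.Properties using (++-identityʳ)
open import Data.List.Membership.Propositional using (_∈_; _∉_; mapWith∈)
open import Data.List.Membership.Propositional.Properties using (∈-++⁻; ∈-++⁺ˡ; ∈-++⁺ʳ)
open import Data.List.Relation.Binary.Subset.Propositional using (_⊆_)
open import Data.List.Relation.Unary.Any using (here; there)
open import Data.List.Relation.Unary.Any.Properties using (mapWith∈⁺; mapWith∈⁻)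
open import Data.Product using (Σ; ∃; _×_; _,_; proj₁; proj₂)
open import Data.Sum using (_⊎_; inj₁; inj₂)
open import Data.Unit using (tt)
open import Function.Bundles using (_⇔_; mk⇔; Equivalence)
open import Relation.Binary.PropositionalEquality using (_≡_; _≢_; refl; subst)
open import Relation.Nullary using (¬_)

module _ {A : Set} {Js : List (List A)} {H : List A} (hits : IsHittingSet Js H) where

  private
    pick : ∀ {J} → J ∈ Js → A
    pick J∈Js = proj₁ (hits J∈Js)

  chosenHitters : List A
  chosenHitters = mapWith∈ Js pick

  chosenHitters-hits : IsHittingSet Js chosenHitters
  chosenHitters-hits {J} J∈Js =
    pick J∈Js , proj₁ (proj₂ (hits J∈Js)) , mapWith∈⁺ pick (J , J∈Js , refl)

  ∈-chosenHitters⁻ : ∀ {x} → x ∈ chosenHitters → x ∈ H × ∃ λ J → J ∈ Js × x ∈ J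
  ∈-chosenHitters⁻ x∈ with mapWith∈⁻ Js pick x∈
  ... | J , J∈Js , refl = proj₂ (proj₂ (hits J∈Js)) , J , J∈Js , proj₁ (proj₂ (hits J∈Js))

-- One chosen element of H per set is a hitting set inside H, so by minimality it is all of H.
minimalHittingSet⊆⋃ : ∀ {A : Set} {Js : List (List A)} {H x} →
                      IsMinimalHittingSet Js H → x ∈ H → ∃ λ J → J ∈ Js × x ∈ J
minimalHittingSet⊆⋃ (hits , minimal) x∈H =
  proj₂ (∈-chosenHitters⁻ hits
          (minimal (chosenHitters hits)
                   (λ y∈ → proj₁ (∈-chosenHitters⁻ hits y∈))
                   (chosenHitters-hits hits) x∈H))

module _ {A : Set} (C : ConsequenceRelation A) where
  open ConsequenceRelation C

  ⊨⇒⊆Con : ∀ {β γ} → [ β ] ⊨ γ → [ γ ] ⊆Con [ β ]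
  ⊨⇒⊆Con β⊨γ φ = cut λ { (here refl) → β⊨γ }

  singleton-justification : ∀ {Os Or α x} → ¬ (Os ⊨ α) → x ∈ Or → (Os ++ [ x ]) ⊨ α →
                            IsJustification Os Or α [ x ]
  singleton-justification {Os} {α = α} Os⊭α x∈Or Os++x⊨α =
    (λ { (here refl) → x∈Or }) , Os++x⊨α , minimal
    where
    minimal : ∀ J' → J' ⊆ [ _ ] → (Os ++ J') ⊨ α → [ _ ] ⊆ J'
    minimal [] _ Os++[]⊨α = ⊥-elim (Os⊭α (subst (_⊨ α) (++-identityʳ Os) Os++[]⊨α))
    minimal (y ∷ _) J'⊆x _ with J'⊆x (here refl)
    ... | here refl = λ { (here refl) → here refl }

  justification≈singleton : ∀ {Os Or α J x} → IsJustification Os Or α J → x ∈ J →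
                            (Os ++ [ x ]) ⊨ α → J ⊆ [ x ] × [ x ] ⊆ J
  justification≈singleton (_ , _ , minimal) x∈J Os++x⊨α =
    minimal [ _ ] x⊆J Os++x⊨α , x⊆J
    where
    x⊆J : [ _ ] ⊆ _
    x⊆J (here refl) = x∈J

singleton-minus-empty : ∀ {A : Set} {β : A} {J⁻} →
                        (∀ x → x ∈ J⁻ ⇔ (x ∈ [ β ] × x ≢ β)) → ∀ {x} → x ∉ J⁻
singleton-minus-empty J⁻≈ x∈J⁻ with Equivalence.to (J⁻≈ _) x∈J⁻
... | here refl , x≢β = x≢β refl

module _ {A : Set} {C : ConsequenceRelation A} (S : RepairSetting A C) where
  open ConsequenceRelation C
  open RepairSetting S

  H⊆Or : H ⊆ Or
  H⊆Or β∈H with minimalHittingSet⊆⋃ H-min β∈H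
  ... | J , J∈Js , β∈J = proj₁ (Js-just J∈Js) β∈J

  repaired⊆Con-original : ∀ O' → IsRepaired O' → (Os ++ O') ⊆Con (Os ++ Or)
  repaired⊆Con-original O' repaired φ = cut entailed
    where
    entailed : ∀ {y} → y ∈ Os ++ O' → (Os ++ Or) ⊨ y
    entailed y∈ with ∈-++⁻ Os y∈
    ... | inj₁ y∈Os = reflexive (∈-++⁺ˡ y∈Os)
    ... | inj₂ y∈O' with Equivalence.to (repaired _) y∈O'
    ...   | inj₁ (y∈Or , _) = reflexive (∈-++⁺ʳ Os y∈Or)
    ...   | inj₂ (β , β∈H , refl) =
            monotone (λ { (here refl) → ∈-++⁺ʳ Os (H⊆Or β∈H) })
                     (proj₁ (γ-weaker β∈H) (γ β) (reflexive (here refl)))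

module _ {A : Set} (IsModel : (A → Bool) → Set) where

  Satisfies : (A → Bool) → List A → Set
  Satisfies M S = ∀ {y} → y ∈ S → T (M y)

  modelConsequence : ConsequenceRelation A
  modelConsequence = record
    { _⊨_       = λ S x → ∀ M → IsModel M → Satisfies M S → T (M x)
    ; reflexive = λ x∈S M _ M⊨S → M⊨S x∈S
    ; monotone  = λ S⊆T S⊨x M isM M⊨T → S⊨x M isM (λ y∈S → M⊨T (S⊆T y∈S))
    ; cut       = λ S⊨T T⊨x M isM M⊨S → T⊨x M isM (λ y∈T → S⊨T y∈T M isM M⊨S)
    }

  open ConsequenceRelation modelConsequence using (_⊨_)

  satisfies-++-singleton : ∀ {M S g} → (∀ {x} → x ∉ S) → T (M g) → Satisfies M (S ++ [ g ])
  satisfies-++-singleton {S = S} S≈∅ Mg y∈ with ∈-++⁻ S y∈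
  ... | inj₁ y∈S        = ⊥-elim (S≈∅ y∈S)
  ... | inj₂ (here refl) = Mg

  countermodel : ∀ {S x} M → IsModel M → Satisfies M S → ¬ T (M x) → ¬ (S ⊨ x)
  countermodel M isM M⊨S M⊭x S⊨x = M⊭x (S⊨x M isM M⊨S)

data Ax : Set where
  a b₁ b₂ g₁ g₂ : Ax

record IsModel (M : Ax → Bool) : Set where
  field
    b₁⇒g₁    : T (M b₁) → T (M g₁)
    b₂⇒g₂    : T (M b₂) → T (M g₂)
    b₁⇒a     : T (M b₁) → T (M a)
    b₂⇒a     : T (M b₂) → T (M a)
    g₁∧g₂⇒a  : T (M g₁) → T (M g₂) → T (M a)

allFalse onlyG₁ onlyG₂ : Ax → Bool
allFalse _ = false
onlyG₁ g₁ = true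
onlyG₁ _  = false
onlyG₂ g₂ = true
onlyG₂ _  = false

allFalse-model : IsModel allFalse
allFalse-model = record { b₁⇒g₁ = λ () ; b₂⇒g₂ = λ () ; b₁⇒a = λ () ; b₂⇒a = λ () ; g₁∧g₂⇒a = λ () }

onlyG₁-model : IsModel onlyG₁
onlyG₁-model = record { b₁⇒g₁ = λ () ; b₂⇒g₂ = λ () ; b₁⇒a = λ () ; b₂⇒a = λ () ; g₁∧g₂⇒a = λ _ () }

onlyG₂-model : IsModel onlyG₂
onlyG₂-model = record { b₁⇒g₁ = λ () ; b₂⇒g₂ = λ () ; b₁⇒a = λ () ; b₂⇒a = λ () ; g₁∧g₂⇒a = λ () }

Horn : ConsequenceRelation Ax
Horn = modelConsequence IsModel

open ConsequenceRelation Horn using (_⊨_; reflexive; monotone; Weaker; IsJustification)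

[]⊭a : ¬ ([] ⊨ a)
[]⊭a = countermodel IsModel allFalse allFalse-model (λ ()) (λ ())

b₁⊨a : [ b₁ ] ⊨ a
b₁⊨a M isM M⊨b₁ = IsModel.b₁⇒a isM (M⊨b₁ (here refl))

b₂⊨a : [ b₂ ] ⊨ a
b₂⊨a M isM M⊨b₂ = IsModel.b₂⇒a isM (M⊨b₂ (here refl))

g₁g₂⊨a : (g₁ ∷ g₂ ∷ []) ⊨ a
g₁g₂⊨a M isM M⊨g = IsModel.g₁∧g₂⇒a isM (M⊨g (here refl)) (M⊨g (there (here refl)))

g₁-weaker : Weaker g₁ b₁
g₁-weaker =
  ⊨⇒⊆Con Horn (λ M isM M⊨b₁ → IsModel.b₁⇒g₁ isM (M⊨b₁ (here refl))) ,
  b₁ , reflexive (here refl) ,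
  countermodel IsModel onlyG₁ onlyG₁-model (λ { (here refl) → tt }) (λ ())

g₂-weaker : Weaker g₂ b₂
g₂-weaker =
  ⊨⇒⊆Con Horn (λ M isM M⊨b₂ → IsModel.b₂⇒g₂ isM (M⊨b₂ (here refl))) ,
  b₂ , reflexive (here refl) ,
  countermodel IsModel onlyG₂ onlyG₂-model (λ { (here refl) → tt }) (λ ())

-- Only the values on b₁ and b₂ matter: the setting applies γ to elements of H.
weaken : Ax → Ax
weaken b₁ = g₁
weaken b₂ = g₂
weaken x  = x

refutable hitting : List Ax
refutable = b₁ ∷ b₂ ∷ []
hitting   = b₁ ∷ b₂ ∷ []

justifications : List (List Ax)
justifications = [ b₁ ] ∷ [ b₂ ] ∷ []

justification-b₁ : IsJustification [] refutable a [ b₁ ]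
justification-b₁ = singleton-justification Horn []⊭a (here refl) b₁⊨a

justification-b₂ : IsJustification [] refutable a [ b₂ ]
justification-b₂ = singleton-justification Horn []⊭a (there (here refl)) b₂⊨a

all-justifications : ∀ J → IsJustification [] refutable a J →
                     ∃ λ J' → J' ∈ justifications × J ⊆ J' × J' ⊆ J
all-justifications [] (_ , []⊨a , _) = ⊥-elim ([]⊭a []⊨a)
all-justifications (x ∷ _) isJ with proj₁ isJ (here refl)
... | here refl         = [ b₁ ] , here refl , justification≈singleton Horn isJ (here refl) b₁⊨a
... | there (here refl) = [ b₂ ] , there (here refl) , justification≈singleton Horn isJ (here refl) b₂⊨a

hitting-minimal : IsMinimalHittingSet justifications hitting
hitting-minimal = hits , minimal
  where
  hits : IsHittingSet justifications hitting
  hits (here refl)         = b₁ , here refl , here refl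
  hits (there (here refl)) = b₂ , here refl , there (here refl)
  minimal : ∀ H' → H' ⊆ hitting → IsHittingSet justifications H' → hitting ⊆ H'
  minimal _ _ hits' (here refl) with hits' (here refl)
  ... | _ , here refl , b₁∈H' = b₁∈H'
  minimal _ _ hits' (there (here refl)) with hits' (there (here refl))
  ... | _ , here refl , b₂∈H' = b₂∈H'

weaken-weaker : ∀ {β} → β ∈ hitting → Weaker (weaken β) β
weaken-weaker (here refl)         = g₁-weaker
weaken-weaker (there (here refl)) = g₂-weaker

weaken-breaks : ∀ {β J} → β ∈ hitting → J ∈ justifications → β ∈ J →
                ∀ J⁻ → (∀ x → x ∈ J⁻ ⇔ (x ∈ J × x ≢ β)) →
                ¬ ((J⁻ ++ [ weaken β ]) ⊨ a)
weaken-breaks (here refl) (here refl) _ J⁻ J⁻≈∅ =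
  countermodel IsModel onlyG₁ onlyG₁-model
    (satisfies-++-singleton IsModel {M = onlyG₁} (singleton-minus-empty J⁻≈∅) tt) (λ ())
weaken-breaks (there (here refl)) (there (here refl)) _ J⁻ J⁻≈∅ =
  countermodel IsModel onlyG₂ onlyG₂-model
    (satisfies-++-singleton IsModel {M = onlyG₂} (singleton-minus-empty J⁻≈∅) tt) (λ ())
weaken-breaks (here refl) (there (here refl)) (here ())
weaken-breaks (there (here refl)) (here refl) (here ())

example : RepairSetting Ax Horn
example = record
  { Os       = []
  ; Or       = refutable
  ; α        = a
  ; O⊨α      = monotone (λ { (here refl) → here refl }) b₁⊨a
  ; Os⊭α     = []⊭a
  ; Js       = justifications
  ; Js-just  = λ { (here refl) → justification-b₁ ; (there (here refl)) → justification-b₂ }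
  ; Js-all   = all-justifications
  ; H        = hitting
  ; H-min    = hitting-minimal
  ; γ        = weaken
  ; γ-weaker = weaken-weaker
  ; γ-breaks = weaken-breaks
  }

weakenedOntology : List Ax
weakenedOntology = g₁ ∷ g₂ ∷ []

weakenedOntology-repaired : RepairSetting.IsRepaired example weakenedOntology
weakenedOntology-repaired x = mk⇔ to from
  where
  to : x ∈ weakenedOntology → (x ∈ refutable × x ∉ hitting) ⊎ (∃ λ β → β ∈ hitting × x ≡ weaken β)
  to (here refl)         = inj₂ (b₁ , here refl , refl)
  to (there (here refl)) = inj₂ (b₂ , there (here refl) , refl)
  from : (x ∈ refutable × x ∉ hitting) ⊎ (∃ λ β → β ∈ hitting × x ≡ weaken β) → x ∈ weakenedOntology
  from (inj₁ (x∈Or , x∉H)) = ⊥-elim (x∉H x∈Or)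
  from (inj₂ (_ , here refl , refl))         = here refl
  from (inj₂ (_ , there (here refl) , refl)) = there (here refl)

lemma3 :
    ( ∀ {A : Set} (C : ConsequenceRelation A) (S : RepairSetting A C) →
        ∀ O' → RepairSetting.IsRepaired S O' →
        ConsequenceRelation._⊆Con_ C (RepairSetting.Os S ++ O')
                                     (RepairSetting.Os S ++ RepairSetting.Or S) )
    ×
    ( ∃ λ (A : Set) → Σ (ConsequenceRelation A) λ C → Σ (RepairSetting A C) λ S →
        ∃ λ O' → RepairSetting.IsRepaired S O' ×
        ConsequenceRelation.Con C (RepairSetting.Os S ++ O') (RepairSetting.α S) )
lemma3 =
  (λ C S → repaired⊆Con-original S) ,
  Ax , Horn , example , weakenedOntology , weakenedOntology-repaired , g₁g₂⊨a
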